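{- Let $\Sigma\subseteq\mathcal L_{\Diamond\forall}$ be closed under subformulas and let $\mathfrak Q=(W,\preccurlyeq,\ell,S)$ be an honest, deterministic $\Sigma$-quasimodel. Consider the dynamical system $(W,\mathcal U_\preccurlyeq,S)$, where $\mathcal U_\preccurlyeq$ is the up-set topology of $\preccurlyeq$, with the valuation $[\![\cdot]\!]_{\mathfrak Q}$ determined by $[\![p]\!]_{\mathfrak Q}=\{w\in W:p\in\ell^+(w)\}$ for each propositional variable $p$ and extended to all formulas by the usual recursive clauses. Then for every $\varphi\in\mathcal L_\Diamond$ and every $w\in W$: (1) if $\varphi\in\ell^+(w)$ then $w\in[\![\varphi]\!]_{\mathfrak Q}$; (2) if $\varphi\in\ell^-(w)$ then $w\notin[\![\varphi]\!]_{\mathfrak Q}$.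
   Context: $\mathcal L_{\Diamond\forall}$: formulas built from $\bot$, propositional variables, $\wedge,\vee,\to$, ${\circ},\Diamond,\forall$; $\mathcal L_\Diamond$ is its $\forall$-free fragment. Recursive clauses for a dynamical system $(X,\mathcal T,f)$: $[\![\bot]\!]=\varnothing$, $\wedge,\vee$ as intersection/union, $[\![\varphi\to\psi]\!]$ = interior of $(X\setminus[\![\varphi]\!])\cup[\![\psi]\!]$, $[\![{\circ}\varphi]\!]=f^{ -1}[\![\varphi]\!]$, $[\![\Diamond\varphi]\!]=\bigcup_{n}f^{ -n}[\![\varphi]\!]$. A $\Sigma$-type is a pair $\Phi=(\Phi^+;\Phi^-)$ of finite subsets of $\Sigma$ with: $\Phi^+\cap\Phi^-=\varnothing$; $\bot\notin\Phi^+$; $\varphi\wedge\psi\in\Phi^+\Rightarrow\varphi,\psi\in\Phi^+$; $\varphi\wedge\psi\in\Phi^-\Rightarrow\varphi\in\Phi^-$ or $\psi\in\Phi^-$; $\varphi\vee\psi\in\Phi^+\Rightarrow\varphi\in\Phi^+$ or $\psi\in\Phi^+$; $\varphi\vee\psi\in\Phi^-\Rightarrow\varphi,\psi\in\Phi^-$; $\varphi\to\psi\in\Phi^+\Rightarrow\varphi\in\Phi^-$ or $\psi\in\Phi^+$; $\varphi\to\psi\in\Phi^-\Rightarrow\psi\in\Phi^-$; $\Diamond\varphi\in\Phi^-\Rightarrow\varphi\in\Phi^-$. $\Phi\preccurlyeq_T\Psi$ means $\Phi^+\subseteq\Psi^+$ and $\Psi^-\subseteq\Phi^-$. A pair $(\Phi,\Psi)$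 of types is sensible if: ${\circ}\varphi\in\Phi^+\Rightarrow\varphi\in\Psi^+$; ${\circ}\varphi\in\Phi^-\Rightarrow\varphi\in\Psi^-$; $\Diamond\varphi\in\Phi^+\Rightarrow\varphi\in\Phi^+$ or $\Diamond\varphi\in\Psi^+$; $\Diamond\varphi\in\Phi^-\Rightarrow\Diamond\varphi\in\Psi^-$; $\forall\varphi\in\Phi^+\Leftrightarrow\forall\varphi\in\Psi^+$; $\forall\varphi\in\Phi^-\Leftrightarrow\forall\varphi\in\Psi^-$. A $\Sigma$-quasimodel is $(W,\preccurlyeq,\ell,S)$ where $(W,\preccurlyeq)$ is a poset; $\ell$ maps $W$ to $\Sigma$-types with $w\preccurlyeq v\Rightarrow\ell(w)\preccurlyeq_T\ell(v)$; whenever $\varphi\to\psi\in\ell^-(w)$ there is $v\succcurlyeq w$ with $\varphi\in\ell^+(v)$, $\psi\in\ell^-(v)$; $S\subseteq W\times W$ is forward confluent (if $w\preccurlyeq w'$ and $w\mathrel S v$ then there is $v'\succcurlyeq v$ with $w'\mathrel S v'$), every pair $(w,v)\in S$ has $(\ell(w),\ell(v))$ sensible, $S$ is serial, and $S$ is $\omega$-sensible: whenever $\Diamond\varphi\in\ell^+(w)$ there are $n\geq0$ and $v$ with $w\mathrel S^n v$ and $\varphi\in\ell^+(v)$. It is deterministic if $S$ is a function. It is honest if for all $w$ and $\forall\varphi\in\Sigma$: $\forall\varphi\in\ell^+(w)$ implies $\varphi\in\ell^+(v)$ for all $v\in W$, and $\forall\varphi\in\ell^-(w)$ implies $\varphi\in\ell^-(v)$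 for some $v\in W$. -}

module Defs where

open import Data.Nat using (ℕ; zero; suc)
open import Data.List using (List)
open import Data.List.Membership.Propositional using (_∈_)
open import Data.Product using (Σ; ∃; _×_; _,_; proj₁)
open import Data.Sum using (_⊎_)
open import Data.Empty using (⊥)
open import Relation.Nullary using (¬_)
open import Relation.Binary.PropositionalEquality using (_≡_)
open import Relation.Binary.Structures using (IsPartialOrder)

infixr 6 _∧_
infixr 5 _∨_
infixr 4 _⇒_

data Form : Set where
  ⊥'  : Form
  var : ℕ → Form
  _∧_ : Form → Form → Form
  _∨_ : Form → Form → Form
  _⇒_ : Form → Form → Form
  ○   : Form → Form
  ◇   : Form → Form
  ∀'  : Form → Form

data L◇ : Form → Set where
  l-⊥   : L◇ ⊥'
  l-var : ∀ p → L◇ (var p)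
  l-∧   : ∀ {a b} → L◇ a → L◇ b → L◇ (a ∧ b)
  l-∨   : ∀ {a b} → L◇ a → L◇ b → L◇ (a ∨ b)
  l-⇒   : ∀ {a b} → L◇ a → L◇ b → L◇ (a ⇒ b)
  l-○   : ∀ {a} → L◇ a → L◇ (○ a)
  l-◇   : ∀ {a} → L◇ a → L◇ (◇ a)

record SubClosed (Sig : Form → Set) : Set where
  field
    c-∧ : ∀ {a b} → Sig (a ∧ b) → Sig a × Sig b
    c-∨ : ∀ {a b} → Sig (a ∨ b) → Sig a × Sig b
    c-⇒ : ∀ {a b} → Sig (a ⇒ b) → Sig a × Sig b
    c-○ : ∀ {a} → Sig (○ a) → Sig a
    c-◇ : ∀ {a} → Sig (◇ a) → Sig a
    c-∀ : ∀ {a} → Sig (∀' a) → Sig a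

record SType (Sig : Form → Set) : Set where
  field
    pos neg  : List Form
    pos⊆Sig  : ∀ {φ} → φ ∈ pos → Sig φ
    neg⊆Sig  : ∀ {φ} → φ ∈ neg → Sig φ
    disjoint : ∀ {φ} → φ ∈ pos → φ ∈ neg → ⊥
    ⊥∉pos    : ¬ (⊥' ∈ pos)
    ∧⁺ : ∀ {a b} → (a ∧ b) ∈ pos → a ∈ pos × b ∈ pos
    ∧⁻ : ∀ {a b} → (a ∧ b) ∈ neg → a ∈ neg ⊎ b ∈ neg
    ∨⁺ : ∀ {a b} → (a ∨ b) ∈ pos → a ∈ pos ⊎ b ∈ pos
    ∨⁻ : ∀ {a b} → (a ∨ b) ∈ neg → a ∈ neg × b ∈ neg
    ⇒⁺ : ∀ {a b} → (a ⇒ b) ∈ pos → a ∈ neg ⊎ b ∈ pos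
    ⇒⁻ : ∀ {a b} → (a ⇒ b) ∈ neg → b ∈ neg
    ◇⁻ : ∀ {a} → ◇ a ∈ neg → a ∈ neg

open SType public

_≼T_ : ∀ {Sig} → SType Sig → SType Sig → Set
Φ ≼T Ψ = (∀ {φ} → φ ∈ pos Φ → φ ∈ pos Ψ) × (∀ {φ} → φ ∈ neg Ψ → φ ∈ neg Φ)

record Sensible {Sig} (Φ Ψ : SType Sig) : Set where
  field
    ○⁺ : ∀ {a} → ○ a ∈ pos Φ → a ∈ pos Ψ
    ○⁻ : ∀ {a} → ○ a ∈ neg Φ → a ∈ neg Ψ
    ◇⁺ : ∀ {a} → ◇ a ∈ pos Φ → a ∈ pos Φ ⊎ ◇ a ∈ pos Ψ
    ◇⁻ : ∀ {a} → ◇ a ∈ neg Φ → ◇ a ∈ neg Ψ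
    ∀⁺→ : ∀ {a} → ∀' a ∈ pos Φ → ∀' a ∈ pos Ψ
    ∀⁺← : ∀ {a} → ∀' a ∈ pos Ψ → ∀' a ∈ pos Φ
    ∀⁻→ : ∀ {a} → ∀' a ∈ neg Φ → ∀' a ∈ neg Ψ
    ∀⁻← : ∀ {a} → ∀' a ∈ neg Ψ → ∀' a ∈ neg Φ

RelPow : ∀ {W : Set} → (W → W → Set) → ℕ → W → W → Set
RelPow S zero    w v = w ≡ v
RelPow S (suc n) w v = ∃ λ u → S w u × RelPow S n u v

record Quasimodel (Sig : Form → Set) : Set₁ where
  field
    W     : Set
    _≼_   : W → W → Set
    isPO  : IsPartialOrder _≡_ _≼_
    ℓ     : W → SType Sig
    ℓ-mono : ∀ {w v} → w ≼ v → ℓ w ≼T ℓ v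
    ⇒-wit : ∀ {w a b} → (a ⇒ b) ∈ neg (ℓ w) →
              ∃ λ v → w ≼ v × a ∈ pos (ℓ v) × b ∈ neg (ℓ v)
    S     : W → W → Set
    fconf : ∀ {w w' v} → w ≼ w' → S w v → ∃ λ v' → v ≼ v' × S w' v'
    sens  : ∀ {w v} → S w v → Sensible (ℓ w) (ℓ v)
    serial : ∀ w → ∃ λ v → S w v
    ω-sens : ∀ {w a} → ◇ a ∈ pos (ℓ w) →
              ∃ λ n → ∃ λ v → RelPow S n w v × a ∈ pos (ℓ v)

open Quasimodel public

Deterministic : ∀ {Sig} → Quasimodel Sig → Set
Deterministic Q = Σ (W Q → W Q) λ f → ∀ w v → (S Q w v → v ≡ f w) × (v ≡ f w → S Q w v)

Honest : ∀ {Sig} → Quasimodel Sig → Set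
Honest Q =
  (∀ w a → ∀' a ∈ pos (ℓ Q w) → ∀ v → a ∈ pos (ℓ Q v)) ×
  (∀ w a → ∀' a ∈ neg (ℓ Q w) → ∃ λ v → a ∈ neg (ℓ Q v))

iter : ∀ {A : Set} → (A → A) → ℕ → A → A
iter f zero    x = x
iter f (suc n) x = f (iter f n x)

-- Denotation in the dynamical system (W, up-set topology of ≼, f), with
-- ⟦p⟧ = {w : p ∈ ℓ⁺(w)}.  Sets are predicates on W.  In the up-set topology,
-- the interior of A is {w : ∀ v ≽ w, v ∈ A}.
module _ {Sig : Form → Set} (Q : Quasimodel Sig) (f : W Q → W Q) where
  private
    X = W Q
    _≤_ = _≼_ Q

  Int : (X → Set) → X → Set
  Int A w = ∀ v → w ≤ v → A v

  ⟦_⟧ : Form → X → Set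
  ⟦ ⊥' ⟧    w = ⊥
  ⟦ var p ⟧ w = var p ∈ pos (ℓ Q w)
  ⟦ a ∧ b ⟧ w = ⟦ a ⟧ w × ⟦ b ⟧ w
  ⟦ a ∨ b ⟧ w = ⟦ a ⟧ w ⊎ ⟦ b ⟧ w
  ⟦ a ⇒ b ⟧ w = Int (λ v → ¬ ⟦ a ⟧ v ⊎ ⟦ b ⟧ v) w
  ⟦ ○ a ⟧   w = ⟦ a ⟧ (f w)
  ⟦ ◇ a ⟧   w = ∃ λ n → ⟦ a ⟧ (iter f n w)
  ⟦ ∀' a ⟧  w = ∀ v → ⟦ a ⟧ v

-- Since S is the graph of f, the S-paths are exactly the f-orbits, so the
-- sensibility of consecutive types carries ○ and ◇ along the orbit and ω-sensibility finds a
-- witness for ◇ on it; for ⇒, monotonicity of ℓ handles ℓ⁺ and the ⇒-witnesses handle ℓ⁻.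
module Submission where

open import Defs
open import Data.List.Membership.Propositional using (_∈_)
open import Data.Nat using (zero; suc)
open import Data.Empty using (⊥-elim)
open import Data.Product using (_×_; proj₁; proj₂; _,_)
open import Data.Sum using (inj₁; inj₂)
open import Relation.Nullary using (¬_)
open import Relation.Binary.PropositionalEquality using (_≡_; refl; trans; subst; cong)

iter-shift : ∀ {A : Set} (f : A → A) n x → iter f n (f x) ≡ f (iter f n x)
iter-shift f zero    x = refl
iter-shift f (suc n) x = cong f (iter-shift f n x)

module _ {Sig : Form → Set} (Q : Quasimodel Sig) (det : Deterministic Q) where

  private
    f : W Q → W Q
    f = proj₁ det

  S-step : ∀ w → S Q w (f w)
  S-step w = proj₂ (proj₂ det w (f w)) refl

  S-functional : ∀ {w v} → S Q w v → v ≡ f w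
  S-functional {w} {v} = proj₁ (proj₂ det w v)

  RelPow⇒iter : ∀ n {w v} → RelPow (S Q) n w v → v ≡ iter f n w
  RelPow⇒iter zero    refl = refl
  RelPow⇒iter (suc n) {w} (u , wSu , uSⁿv) with S-functional wSu
  ... | refl = trans (RelPow⇒iter n uSⁿv) (iter-shift f n w)

  ◇⁻-along-orbit : ∀ {a w} → ◇ a ∈ neg (ℓ Q w) → ∀ k → ◇ a ∈ neg (ℓ Q (iter f k w))
  ◇⁻-along-orbit ◇a⁻ zero    = ◇a⁻
  ◇⁻-along-orbit ◇a⁻ (suc k) =
    Sensible.◇⁻ (sens Q (S-step _)) (◇⁻-along-orbit ◇a⁻ k)

  Truthful : Form → W Q → Set
  Truthful φ w = (φ ∈ pos (ℓ Q w) → ⟦ Q ⟧ f φ w) × (φ ∈ neg (ℓ Q w) → ¬ ⟦ Q ⟧ f φ w)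

  Truthful-⊥ : ∀ w → Truthful ⊥' w
  Truthful-⊥ w = (λ ⊥⁺ → ⊥-elim (⊥∉pos (ℓ Q w) ⊥⁺)) , (λ _ ())

  Truthful-var : ∀ p w → Truthful (var p) w
  Truthful-var p w = (λ p⁺ → p⁺) , (λ p⁻ p⁺ → disjoint (ℓ Q w) p⁺ p⁻)

  Truthful-∧ : ∀ {a b w} → Truthful a w → Truthful b w → Truthful (a ∧ b) w
  Truthful-∧ {a} {b} {w} (a⁺ , a⁻) (b⁺ , b⁻) = pos-case , neg-case
    where
    pos-case : (a ∧ b) ∈ pos (ℓ Q w) → ⟦ Q ⟧ f (a ∧ b) w
    pos-case ∧⁺' with ∧⁺ (ℓ Q w) ∧⁺'
    ... | inA , inB = a⁺ inA , b⁺ inB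
    neg-case : (a ∧ b) ∈ neg (ℓ Q w) → ¬ ⟦ Q ⟧ f (a ∧ b) w
    neg-case ∧⁻' (x , y) with ∧⁻ (ℓ Q w) ∧⁻'
    ... | inj₁ inA = a⁻ inA x
    ... | inj₂ inB = b⁻ inB y

  Truthful-∨ : ∀ {a b w} → Truthful a w → Truthful b w → Truthful (a ∨ b) w
  Truthful-∨ {a} {b} {w} (a⁺ , a⁻) (b⁺ , b⁻) = pos-case , neg-case
    where
    pos-case : (a ∨ b) ∈ pos (ℓ Q w) → ⟦ Q ⟧ f (a ∨ b) w
    pos-case ∨⁺' with ∨⁺ (ℓ Q w) ∨⁺'
    ... | inj₁ inA = inj₁ (a⁺ inA)
    ... | inj₂ inB = inj₂ (b⁺ inB)
    neg-case : (a ∨ b) ∈ neg (ℓ Q w) → ¬ ⟦ Q ⟧ f (a ∨ b) w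
    neg-case ∨⁻' (inj₁ x) = a⁻ (proj₁ (∨⁻ (ℓ Q w) ∨⁻')) x
    neg-case ∨⁻' (inj₂ y) = b⁻ (proj₂ (∨⁻ (ℓ Q w) ∨⁻')) y

  Truthful-⇒ : ∀ {a b} → (∀ v → Truthful a v) → (∀ v → Truthful b v) →
               ∀ w → Truthful (a ⇒ b) w
  Truthful-⇒ {a} {b} ta tb w = pos-case , neg-case
    where
    pos-case : (a ⇒ b) ∈ pos (ℓ Q w) → ⟦ Q ⟧ f (a ⇒ b) w
    pos-case ⇒⁺' v w≼v with ⇒⁺ (ℓ Q v) (proj₁ (ℓ-mono Q w≼v) ⇒⁺')
    ... | inj₁ inA = inj₁ (proj₂ (ta v) inA)
    ... | inj₂ inB = inj₂ (proj₁ (tb v) inB)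
    neg-case : (a ⇒ b) ∈ neg (ℓ Q w) → ¬ ⟦ Q ⟧ f (a ⇒ b) w
    neg-case ⇒⁻' a⇒b with ⇒-wit Q ⇒⁻'
    ... | v , w≼v , inA , inB with a⇒b v w≼v
    ...   | inj₁ ¬a = ¬a (proj₁ (ta v) inA)
    ...   | inj₂ y  = proj₂ (tb v) inB y

  Truthful-○ : ∀ {a w} → Truthful a (f w) → Truthful (○ a) w
  Truthful-○ {w = w} (a⁺ , a⁻) =
    (λ ○⁺' → a⁺ (Sensible.○⁺ (sens Q (S-step w)) ○⁺')) ,
    (λ ○⁻' → a⁻ (Sensible.○⁻ (sens Q (S-step w)) ○⁻'))

  Truthful-◇ : ∀ {a} → (∀ v → Truthful a v) → ∀ w → Truthful (◇ a) w
  Truthful-◇ {a} ta w = pos-case , neg-case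
    where
    pos-case : ◇ a ∈ pos (ℓ Q w) → ⟦ Q ⟧ f (◇ a) w
    pos-case ◇⁺' with ω-sens Q ◇⁺'
    ... | n , v , wSⁿv , inA =
      n , subst (⟦ Q ⟧ f a) (RelPow⇒iter n wSⁿv) (proj₁ (ta v) inA)
    neg-case : ◇ a ∈ neg (ℓ Q w) → ¬ ⟦ Q ⟧ f (◇ a) w
    neg-case ◇⁻' (k , x) =
      proj₂ (ta (iter f k w)) (◇⁻ (ℓ Q (iter f k w)) (◇⁻-along-orbit ◇⁻' k)) x

  truth-lemma : ∀ φ → L◇ φ → ∀ w → Truthful φ w
  truth-lemma _ l-⊥         = Truthful-⊥
  truth-lemma _ (l-var p)   = Truthful-var p
  truth-lemma _ (l-∧ la lb) w = Truthful-∧ (truth-lemma _ la w) (truth-lemma _ lb w)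
  truth-lemma _ (l-∨ la lb) w = Truthful-∨ (truth-lemma _ la w) (truth-lemma _ lb w)
  truth-lemma _ (l-⇒ la lb) = Truthful-⇒ (truth-lemma _ la) (truth-lemma _ lb)
  truth-lemma _ (l-○ la)    w = Truthful-○ (truth-lemma _ la (f w))
  truth-lemma _ (l-◇ la)    = Truthful-◇ (truth-lemma _ la)

-- Closure under subformulas and honesty only matter for ∀, which does not occur in L◇.
lemma4p7 : {Sig : Form → Set} → SubClosed Sig → (Q : Quasimodel Sig) → Honest Q →
    (det : Deterministic Q) → (φ : Form) → L◇ φ → (w : W Q) →
    (φ ∈ pos (ℓ Q w) → ⟦ Q ⟧ (proj₁ det) φ w) × (φ ∈ neg (ℓ Q w) → ¬ ⟦ Q ⟧ (proj₁ det) φ w)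
lemma4p7 _ Q _ det = truth-lemma Q det
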